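{- Let $n>1$ and $m$ be integers with $0<m<n$, and let $\mathcal{F}(n,m)=(\tfrac{h}{k}\in\mathcal{F}_n:\ h\le m,\ k-h\le n-m)$. Let $\mathcal{F}^{\le 1/2}(n,m)=(\tfrac{h}{k}\in\mathcal{F}(n,m):\ \tfrac{h}{k}\le\tfrac12)$ and $\mathcal{F}^{\ge 1/2}(n,m)=(\tfrac{h}{k}\in\mathcal{F}(n,m):\ \tfrac{h}{k}\ge\tfrac12)$. Then the following maps are well defined, order-preserving and bijective: (1) $\mathcal{F}^{\le1/2}(n,m)\to\mathcal{F}^m_{n-m}$, $\tfrac{h}{k}\mapsto\tfrac{h}{k-h}$; (2) $\mathcal{F}^m_{n-m}\to\mathcal{F}^{\le1/2}(n,m)$, $\tfrac{h}{k}\mapsto\tfrac{h}{k+h}$; (3) $\mathcal{F}^{\ge1/2}(n,m)\to\mathcal{G}_m^{2m-n}$, $\tfrac{h}{k}\mapsto\tfrac{2h-k}{h}$; (4) $\mathcal{G}_m^{2m-n}\to\mathcal{F}^{\ge1/2}(n,m)$, $\tfrac{h}{k}\mapsto\tfrac{k}{2k-h}$. Moreover, the following maps are well defined, order-reversing and bijective: (5) $\mathcal{F}^{\le1/2}(n,m)\to\mathcal{G}^{n-2m}_{n-m}$, $\tfrac{h}{k}\mapsto\tfrac{k-2h}{k-h}$; (6) $\mathcal{G}^{n-2m}_{n-m}\to\mathcal{F}^{\le1/2}(n,m)$, $\tfrac{h}{k}\mapsto\tfrac{k-h}{2k-h}$; (7) $\mathcal{F}^{\ge1/2}(n,m)\to\mathcal{F}^{n-m}_m$,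 $\tfrac{h}{k}\mapsto\tfrac{k-h}{h}$; (8) $\mathcal{F}^{n-m}_m\to\mathcal{F}^{\ge1/2}(n,m)$, $\tfrac{h}{k}\mapsto\tfrac{k}{k+h}$.
   Context: For an integer $q\ge1$, the Farey sequence $\mathcal{F}_q$ is the ascending sequence of all irreducible fractions $\tfrac{h}{k}$ (with $h\ge0$, $k\ge1$, $\gcd(h,k)=1$) such that $\tfrac01\le\tfrac hk\le\tfrac11$ and $1\le k\le q$. For integers $q\ge1$ and $p$: $\mathcal{F}_q^p=(\tfrac hk\in\mathcal{F}_q:\ h\le p)$ and $\mathcal{G}_q^p=(\tfrac hk\in\mathcal{F}_q:\ k-h\le q-p)$, fractions in lowest terms. The sequence $\mathcal{F}(n,m)$ coincides with the set of fractions $\rho(b\wedge a)/\rho(b)$ (reduced), $b$ ranging over nonminimal elements of the Boolean lattice of rank $n$, where $a$ is a fixed element of rank $m$ and $\rho$ is the rank function; in the paper it is denoted $\mathcal{F}(\mathbb{B}(n),m)$. All sequences are ordered by the usual order of rationals; the formulas in the maps are applied to the fraction in lowest terms (the resulting fractions are automatically in lowest terms). -}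

module Defs where

open import Data.Nat using (ℕ; zero; suc; _+_; _*_; _∸_; _≤_; _<_)
open import Data.Nat.GCD using (gcd)
open import Data.Integer as ℤ using (ℤ; +_)
open import Data.Product using (_×_; _,_; ∃-syntax)
open import Relation.Binary.PropositionalEquality using (_≡_)

-- A fraction h/k is represented by the pair (h , k) of naturals.
Frac : Set
Frac = ℕ × ℕ

Farey : ℕ → Frac → Set
Farey q (h , k) = gcd h k ≡ 1 × 1 ≤ k × k ≤ q × h ≤ k

FareyF : ℕ → ℤ → Frac → Set
FareyF q p (h , k) = Farey q (h , k) × (+ h) ℤ.≤ p

FareyG : ℕ → ℤ → Frac → Set
FareyG q p (h , k) = Farey q (h , k) × ((+ k) ℤ.- (+ h)) ℤ.≤ ((+ q) ℤ.- p)

FNM : ℕ → ℕ → Frac → Set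
FNM n m (h , k) = Farey n (h , k) × h ≤ m × ((+ k) ℤ.- (+ h)) ℤ.≤ ((+ n) ℤ.- (+ m))

-- order of rationals on fractions with positive denominators
_≤F_ : Frac → Frac → Set
(h , k) ≤F (h' , k') = h * k' ≤ h' * k

FNM≤½ : ℕ → ℕ → Frac → Set
FNM≤½ n m x = FNM n m x × x ≤F (1 , 2)

FNM≥½ : ℕ → ℕ → Frac → Set
FNM≥½ n m x = FNM n m x × (1 , 2) ≤F x

WellDefined : (Frac → Set) → (Frac → Set) → (Frac → Frac) → Set
WellDefined D C f = ∀ x → D x → C (f x)

OrderPreserving : (Frac → Set) → (Frac → Frac) → Set
OrderPreserving D f = ∀ x y → D x → D y → x ≤F y → f x ≤F f y

OrderReversing : (Frac → Set) → (Frac → Frac) → Set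
OrderReversing D f = ∀ x y → D x → D y → x ≤F y → f y ≤F f x

Bijective : (Frac → Set) → (Frac → Set) → (Frac → Frac) → Set
Bijective D C f =
  (∀ x y → D x → D y → f x ≡ f y → x ≡ y) ×
  (∀ y → C y → ∃[ x ] (D x × f x ≡ y))

IncBij : (Frac → Set) → (Frac → Set) → (Frac → Frac) → Set
IncBij D C f = WellDefined D C f × OrderPreserving D f × Bijective D C f

DecBij : (Frac → Set) → (Frac → Set) → (Frac → Frac) → Set
DecBij D C f = WellDefined D C f × OrderReversing D f × Bijective D C f

-- the eight maps (natural subtraction is exact on the respective domains)
map1 map2 map3 map4 map5 map6 map7 map8 : Frac → Frac
map1 (h , k) = (h , k ∸ h)
map2 (h , k) = (h , k + h)
map3 (h , k) = (2 * h ∸ k , h)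
map4 (h , k) = (k , 2 * k ∸ h)
map5 (h , k) = (k ∸ 2 * h , k ∸ h)
map6 (h , k) = (k ∸ h , 2 * k ∸ h)
map7 (h , k) = (k ∸ h , h)
map8 (h , k) = (k , k + h)

{-# OPTIONS --safe #-}
-- Write a fraction h/k ≤ 1 as h/(h + d). The complement h/(h + d) ↦ d/(h + d) reverses the
-- order, the shift h/(d + h) ↦ h/d preserves it, and both preserve coprimality. Each set of the
-- theorem is cut out by bounds on h, d and k: the complement exchanges the bounds on h and d, and
-- the shift trades the bound on k for one on d. So map1 and map2 are mutually inverse, and the
-- other six maps agree on their domains with composites of map1, map2 and the complement.
module Submission where

open import Defs
open import Data.Nat using (ℕ; zero; suc; _<_; _∸_; _*_; _+_; _≤_; z≤n; s≤s)
open import Data.Nat.Properties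
open import Data.Nat.Divisibility using (_∣_; ∣m∣n⇒∣m+n; ∣m+n∣m⇒∣n)
open import Data.Nat.GCD using (gcd)
open import Data.Nat.Coprimality as Coprimality using (Coprime; gcd≡1⇒coprime; coprime⇒gcd≡1)
open import Data.Integer as ℤ using (+_)
import Data.Integer.Properties as ℤₚ
import Data.Integer.Tactic.RingSolver as ℤ-Solver
open import Data.Product using (_×_; _,_)
open import Function using (_∘_; _⇔_; mk⇔; Equivalence)
open import Relation.Binary.PropositionalEquality

private
  variable
    h d k m m' n q : ℕ
    D C E : Frac → Set
    f g f' g' : Frac → Frac

record Inverse (D C : Frac → Set) (f g : Frac → Frac) : Set where
  field
    to      : WellDefined D C f
    from    : WellDefined C D g
    from∘to : ∀ x → D x → g (f x) ≡ x
    to∘from : ∀ y → C y → f (g y) ≡ y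

  sym-inverse : Inverse C D g f
  sym-inverse = record { to = from ; from = to ; from∘to = to∘from ; to∘from = from∘to }

  bijective : Bijective D C f
  bijective =
    (λ x y dx dy fx≡fy → trans (sym (from∘to x dx)) (trans (cong g fx≡fy) (from∘to y dy))) ,
    (λ y cy → g y , from y cy , to∘from y cy)

open Inverse

Inverse-∘ : Inverse D C f g → Inverse C E f' g' → Inverse D E (f' ∘ f) (g ∘ g')
Inverse-∘ {f = f} {g = g} {f' = f'} {g' = g'} I J = record
  { to      = λ x dx → to J (f x) (to I x dx)
  ; from    = λ z ez → from I (g' z) (from J z ez)
  ; from∘to = λ x dx → trans (cong g (from∘to J (f x) (to I x dx))) (from∘to I x dx)
  ; to∘from = λ z ez → trans (cong f' (to∘from I (g' z) (from J z ez))) (to∘from J z ez)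
  }

EqualOn : (Frac → Set) → (Frac → Frac) → (Frac → Frac) → Set
EqualOn D f g = ∀ x → D x → f x ≡ g x

Inverse-equalOn : EqualOn D f' f → EqualOn C g' g → Inverse D C f g → Inverse D C f' g'
Inverse-equalOn {D} {f'} {f} {C} {g'} {g} f'≡f g'≡g I = record
  { to      = λ x dx → subst C (sym (f'≡f x dx)) (to I x dx)
  ; from    = λ y cy → subst D (sym (g'≡g y cy)) (from I y cy)
  ; from∘to = λ x dx → begin
      g' (f' x) ≡⟨ cong g' (f'≡f x dx) ⟩
      g' (f x)  ≡⟨ g'≡g (f x) (to I x dx) ⟩
      g (f x)   ≡⟨ from∘to I x dx ⟩
      x         ∎
  ; to∘from = λ y cy → begin
      f' (g' y) ≡⟨ cong f' (g'≡g y cy) ⟩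
      f' (g y)  ≡⟨ f'≡f (g y) (from I y cy) ⟩
      f (g y)   ≡⟨ to∘from I y cy ⟩
      y         ∎
  }
  where open ≡-Reasoning

Monotone Antitone : (Frac → Frac) → Set
Monotone f = ∀ x y → x ≤F y → f x ≤F f y
Antitone f = ∀ x y → x ≤F y → f y ≤F f x

antitone∘monotone : Antitone g → Monotone f → Antitone (g ∘ f)
antitone∘monotone {f = f} g↓ f↑ x y x≤y = g↓ (f x) (f y) (f↑ x y x≤y)

monotone∘antitone : Monotone g → Antitone f → Antitone (g ∘ f)
monotone∘antitone {f = f} g↑ f↓ x y x≤y = g↑ (f y) (f x) (f↓ x y x≤y)

antitone∘antitone : Antitone g → Antitone f → Monotone (g ∘ f)
antitone∘antitone {f = f} g↓ f↓ x y x≤y = g↓ (f y) (f x) (f↓ x y x≤y)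

preserving-equalOn : EqualOn D f g → Monotone g → OrderPreserving D f
preserving-equalOn f≡g g↑ x y dx dy x≤y =
  subst₂ _≤F_ (sym (f≡g x dx)) (sym (f≡g y dy)) (g↑ x y x≤y)

reversing-equalOn : EqualOn D f g → Antitone g → OrderReversing D f
reversing-equalOn f≡g g↓ x y dx dy x≤y =
  subst₂ _≤F_ (sym (f≡g y dy)) (sym (f≡g x dx)) (g↓ x y x≤y)

Inverse⇒IncBij : Inverse D C f g → OrderPreserving D f → OrderPreserving C g →
                 IncBij D C f × IncBij C D g
Inverse⇒IncBij I f↑ g↑ = (to I , f↑ , bijective I) , (from I , g↑ , bijective (sym-inverse I))

Inverse⇒DecBij : Inverse D C f g → OrderReversing D f → OrderReversing C g →
                 DecBij D C f × DecBij C D g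
Inverse⇒DecBij I f↓ g↓ = (to I , f↓ , bijective I) , (from I , g↓ , bijective (sym-inverse I))

complement : Frac → Frac
complement (h , k) = (k ∸ h , k)

complement-antitone : Antitone complement
complement-antitone (h , k) (h' , k') hk'≤h'k = begin
  (k' ∸ h') * k   ≡⟨ *-distribʳ-∸ k k' h' ⟩
  k' * k ∸ h' * k ≤⟨ ∸-mono (≤-reflexive (*-comm k' k)) hk'≤h'k ⟩
  k * k' ∸ h * k' ≡⟨ *-distribʳ-∸ k' k h ⟨
  (k ∸ h) * k'    ∎
  where open ≤-Reasoning

map1-monotone : Monotone map1
map1-monotone (h , k) (h' , k') hk'≤h'k = begin
  h * (k' ∸ h')   ≡⟨ *-distribˡ-∸ h k' h' ⟩
  h * k' ∸ h * h' ≤⟨ ∸-mono hk'≤h'k (≤-reflexive (*-comm h' h)) ⟩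
  h' * k ∸ h' * h ≡⟨ *-distribˡ-∸ h' k h ⟨
  h' * (k ∸ h)    ∎
  where open ≤-Reasoning

map2-monotone : Monotone map2
map2-monotone (h , k) (h' , k') hk'≤h'k = begin
  h * (k' + h')   ≡⟨ *-distribˡ-+ h k' h' ⟩
  h * k' + h * h' ≤⟨ +-mono-≤ hk'≤h'k (≤-reflexive (*-comm h h')) ⟩
  h' * k + h' * h ≡⟨ *-distribˡ-+ h' k h ⟨
  h' * (k + h)    ∎
  where open ≤-Reasoning

AtMostOne : (Frac → Set) → Set
AtMostOne D = ∀ {h k} → D (h , k) → h ≤ k

complement-inverse : AtMostOne D → AtMostOne C →
  (∀ {h d k} → h + d ≡ k → D (h , k) → C (d , k)) →
  (∀ {h d k} → h + d ≡ k → C (h , k) → D (d , k)) →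
  Inverse D C complement complement
complement-inverse D⊆≤ C⊆≤ D⇒C C⇒D = record
  { to      = λ (h , k) dx → D⇒C (m+[n∸m]≡n (D⊆≤ dx)) dx
  ; from    = λ (h , k) cy → C⇒D (m+[n∸m]≡n (C⊆≤ cy)) cy
  ; from∘to = λ (h , k) dx → cong (_, k) (m∸[m∸n]≡n (D⊆≤ dx))
  ; to∘from = λ (h , k) cy → cong (_, k) (m∸[m∸n]≡n (C⊆≤ cy))
  }

shift-inverse : AtMostOne D → (∀ {h d k} → d + h ≡ k → D (h , k) ⇔ C (h , d)) →
  Inverse D C map1 map2
shift-inverse D⊆≤ D⇔C = record
  { to      = λ (h , k) dx → Equivalence.to (D⇔C (m∸n+n≡m (D⊆≤ dx))) dx
  ; from    = λ (h , d) cy → Equivalence.from (D⇔C refl) cy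
  ; from∘to = λ (h , k) dx → cong (h ,_) (m∸n+n≡m (D⊆≤ dx))
  ; to∘from = λ (h , d) _ → cong (h ,_) (m+n∸n≡m d h)
  }

0<m+n⇒n≤m⇒0<m : 0 < m + n → n ≤ m → 0 < m
0<m+n⇒n≤m⇒0<m {zero}  0<n z≤n = 0<n
0<m+n⇒n≤m⇒0<m {suc m} _   _   = s≤s z≤n

coprime-+ʳ⇔ : Coprime h (d + h) ⇔ Coprime h d
coprime-+ʳ⇔ {h} {d} = mk⇔
  (λ c {i} (i∣h , i∣d) → c (i∣h , ∣m∣n⇒∣m+n i∣d i∣h))
  (λ c {i} (i∣h , i∣d+h) → c (i∣h , ∣m+n∣m⇒∣n (subst (i ∣_) (+-comm d h) i∣d+h) i∣h))

coprime-complement : Coprime h (h + d) → Coprime d (h + d)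
coprime-complement {h} {d} c {i} (i∣d , i∣h+d) =
  c (∣m+n∣m⇒∣n (subst (i ∣_) (+-comm h d) i∣h+d) i∣d , i∣h+d)

gcd≡1-shift : d + h ≡ k → gcd h k ≡ 1 ⇔ gcd h d ≡ 1
gcd≡1-shift {d} {h} refl = mk⇔
  (coprime⇒gcd≡1 ∘ Equivalence.to coprime-+ʳ⇔ ∘ gcd≡1⇒coprime {h} {d + h})
  (coprime⇒gcd≡1 ∘ Equivalence.from coprime-+ʳ⇔ ∘ gcd≡1⇒coprime {h} {d})

Farey-complement : h + d ≡ k → Farey q (h , k) → Farey q (d , k)
Farey-complement {h} {d} refl (gcd≡1 , 1≤k , k≤q , _) =
  coprime⇒gcd≡1 (coprime-complement (gcd≡1⇒coprime {h} {h + d} gcd≡1)) , 1≤k , k≤q , m≤n+m d h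

m+n≡o⇒+o-+m≡+n : h + d ≡ k → + k ℤ.- + h ≡ + d
m+n≡o⇒+o-+m≡+n {h} {d} refl =
  trans (ℤₚ.m-n≡m⊖n (h + d) h) (trans (ℤₚ.⊖-≥ (m≤m+n h d)) (cong +_ (m+n∸m≡n h d)))

difference-≤⇔ : h + d ≡ k → m + m' ≡ n → (+ k ℤ.- + h) ℤ.≤ (+ n ℤ.- + m) ⇔ d ≤ m'
difference-≤⇔ {h} {d} {m = m} {m'} h+d≡k m+m'≡n = mk⇔
  (ℤₚ.drop‿+≤+ ∘ subst₂ ℤ._≤_ k−h≡d n−m≡m')
  (subst₂ ℤ._≤_ (sym k−h≡d) (sym n−m≡m') ∘ ℤ.+≤+)
  where
  k−h≡d = m+n≡o⇒+o-+m≡+n {h} {d} h+d≡k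
  n−m≡m' = m+n≡o⇒+o-+m≡+n {m} {m'} m+m'≡n

≤½⇔ : h + d ≡ k → (h , k) ≤F (1 , 2) ⇔ h ≤ d
≤½⇔ {h} {d} refl rewrite *-comm h 2 | *-identityˡ (h + d) | +-identityʳ h =
  mk⇔ (+-cancelˡ-≤ h h d) (+-monoʳ-≤ h)

≥½⇔ : h + d ≡ k → (1 , 2) ≤F (h , k) ⇔ d ≤ h
≥½⇔ {h} {d} refl rewrite *-comm h 2 | *-identityˡ (h + d) | +-identityʳ h =
  mk⇔ (+-cancelˡ-≤ h d h) (+-monoʳ-≤ h)

FNM⇔bounds : h + d ≡ k → m + m' ≡ n → FNM n m (h , k) ⇔ (Farey n (h , k) × h ≤ m × d ≤ m')
FNM⇔bounds h+d≡k m+m'≡n = mk⇔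
  (λ (farey , h≤m , diff) → farey , h≤m , Equivalence.to (difference-≤⇔ h+d≡k m+m'≡n) diff)
  (λ (farey , h≤m , d≤m') → farey , h≤m , Equivalence.from (difference-≤⇔ h+d≡k m+m'≡n) d≤m')

FNM-complement : h + d ≡ k → m + m' ≡ n → FNM n m (h , k) → FNM n m' (d , k)
FNM-complement {h} {d} {m = m} {m'} h+d≡k m+m'≡n x
  with farey , h≤m , d≤m' ← Equivalence.to (FNM⇔bounds h+d≡k m+m'≡n) x =
  Equivalence.from (FNM⇔bounds (trans (+-comm d h) h+d≡k) (trans (+-comm m' m) m+m'≡n))
    (Farey-complement h+d≡k farey , d≤m' , h≤m)

FNM≥½⇒FNM≤½ : h + d ≡ k → m + m' ≡ n → FNM≥½ n m (h , k) → FNM≤½ n m' (d , k)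
FNM≥½⇒FNM≤½ {h} {d} h+d≡k m+m'≡n (x , half) =
  FNM-complement h+d≡k m+m'≡n x ,
  Equivalence.from (≤½⇔ {d} {h} (trans (+-comm d h) h+d≡k))
    (Equivalence.to (≥½⇔ {h} {d} h+d≡k) half)

FNM≤½⇒FNM≥½ : h + d ≡ k → m + m' ≡ n → FNM≤½ n m (h , k) → FNM≥½ n m' (d , k)
FNM≤½⇒FNM≥½ {h} {d} h+d≡k m+m'≡n (x , half) =
  FNM-complement h+d≡k m+m'≡n x ,
  Equivalence.from (≥½⇔ {d} {h} (trans (+-comm d h) h+d≡k))
    (Equivalence.to (≤½⇔ {h} {d} h+d≡k) half)

FNM≤½-atMostOne : AtMostOne (FNM≤½ n m)
FNM≤½-atMostOne (((_ , _ , _ , h≤k) , _) , _) = h≤k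

FNM≥½-atMostOne : AtMostOne (FNM≥½ n m)
FNM≥½-atMostOne (((_ , _ , _ , h≤k) , _) , _) = h≤k

FareyF-atMostOne : ∀ {p} → AtMostOne (FareyF q p)
FareyF-atMostOne ((_ , _ , _ , h≤k) , _) = h≤k

FareyG-atMostOne : ∀ {p} → AtMostOne (FareyG q p)
FareyG-atMostOne ((_ , _ , _ , h≤k) , _) = h≤k

FNM-complement-inverse : m + m' ≡ n → Inverse (FNM≥½ n m) (FNM≤½ n m') complement complement
FNM-complement-inverse {m} {m'} m+m'≡n = complement-inverse FNM≥½-atMostOne FNM≤½-atMostOne
  (λ h+d≡k → FNM≥½⇒FNM≤½ h+d≡k m+m'≡n)
  (λ h+d≡k → FNM≤½⇒FNM≥½ h+d≡k (trans (+-comm m' m) m+m'≡n))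

FareyF-complement-inverse : ∀ {p p'} → p ℤ.+ p' ≡ + q →
  Inverse (FareyF q p) (FareyG q p') complement complement
FareyF-complement-inverse {q} {p} {p'} p+p'≡q =
  complement-inverse (FareyF-atMostOne {p = p}) (FareyG-atMostOne {p = p'})
  (λ {h} {d} h+d≡k (farey , h≤p) →
    Farey-complement h+d≡k farey ,
    subst₂ ℤ._≤_ (sym (m+n≡o⇒+o-+m≡+n {d} {h} (trans (+-comm d h) h+d≡k))) (sym q−p'≡p) h≤p)
  (λ {h} {d} h+d≡k (farey , k−h≤q−p') →
    Farey-complement h+d≡k farey ,
    subst₂ ℤ._≤_ (m+n≡o⇒+o-+m≡+n {h} {d} h+d≡k) q−p'≡p k−h≤q−p')
  where
  q−p'≡p : + q ℤ.- p' ≡ p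
  q−p'≡p = begin
    + q ℤ.- p'         ≡⟨ cong (ℤ._- p') p+p'≡q ⟨
    p ℤ.+ p' ℤ.- p'    ≡⟨ ℤₚ.+-assoc p p' (ℤ.- p') ⟩
    p ℤ.+ (p' ℤ.- p')  ≡⟨ cong (λ z → p ℤ.+ z) (ℤₚ.+-inverseʳ p') ⟩
    p ℤ.+ ℤ.0ℤ         ≡⟨ ℤₚ.+-identityʳ p ⟩
    p                  ∎
    where open ≡-Reasoning

map1-map2-inverse : m + m' ≡ n → Inverse (FNM≤½ n m) (FareyF m' (+ m)) map1 map2
map1-map2-inverse {m} {m'} {n} m+m'≡n = shift-inverse FNM≤½-atMostOne FNM≤½⇔FareyF
  where
  FNM≤½⇔FareyF : d + h ≡ k → FNM≤½ n m (h , k) ⇔ FareyF m' (+ m) (h , d)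
  FNM≤½⇔FareyF {d} {h} {k} d+h≡k = mk⇔ forth back
    where
    h+d≡k : h + d ≡ k
    h+d≡k = trans (+-comm h d) d+h≡k

    forth : FNM≤½ n m (h , k) → FareyF m' (+ m) (h , d)
    forth (x , half)
      with (gcd≡1 , 1≤k , _) , h≤m , d≤m' ← Equivalence.to (FNM⇔bounds h+d≡k m+m'≡n) x =
      (Equivalence.to (gcd≡1-shift {d} {h} d+h≡k) gcd≡1 , 1≤d , d≤m' , h≤d) , ℤ.+≤+ h≤m
      where
      h≤d : h ≤ d
      h≤d = Equivalence.to (≤½⇔ h+d≡k) half
      1≤d : 1 ≤ d
      1≤d = 0<m+n⇒n≤m⇒0<m (≤-trans 1≤k (≤-reflexive (sym d+h≡k))) h≤d

    back : FareyF m' (+ m) (h , d) → FNM≤½ n m (h , k)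
    back ((gcd≡1 , 1≤d , d≤m' , h≤d) , +h≤+m) =
      Equivalence.from (FNM⇔bounds h+d≡k m+m'≡n)
        ((Equivalence.from (gcd≡1-shift {d} {h} d+h≡k) gcd≡1 , 1≤k , k≤n , h≤k) , h≤m , d≤m') ,
      Equivalence.from (≤½⇔ h+d≡k) h≤d
      where
      open ≤-Reasoning
      h≤m : h ≤ m
      h≤m = ℤₚ.drop‿+≤+ +h≤+m
      1≤k : 1 ≤ k
      1≤k = begin 1 ≤⟨ 1≤d ⟩ d ≤⟨ m≤m+n d h ⟩ d + h ≡⟨ d+h≡k ⟩ k ∎
      k≤n : k ≤ n
      k≤n = begin
        k      ≡⟨ d+h≡k ⟨
        d + h  ≤⟨ +-mono-≤ d≤m' h≤m ⟩
        m' + m ≡⟨ +-comm m' m ⟩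
        m + m' ≡⟨ m+m'≡n ⟩
        n      ∎
      h≤k : h ≤ k
      h≤k = begin h ≤⟨ m≤n+m h d ⟩ d + h ≡⟨ d+h≡k ⟩ k ∎

equalOn-atMostOne : AtMostOne D → (∀ {h k} → h ≤ k → f (h , k) ≡ g (h , k)) → EqualOn D f g
equalOn-atMostOne D⊆≤ f≡g (h , k) dx = f≡g (D⊆≤ dx)

2*m≡m+m : ∀ m → 2 * m ≡ m + m
2*m≡m+m m = cong (_+_ m) (+-identityʳ m)

2*k∸h≡k+[k∸h] : h ≤ k → 2 * k ∸ h ≡ k + (k ∸ h)
2*k∸h≡k+[k∸h] {h} {k} h≤k = trans (cong (_∸ h) (2*m≡m+m k)) (+-∸-assoc k h≤k)

2*h∸k≡h∸[k∸h] : h ≤ k → 2 * h ∸ k ≡ h ∸ (k ∸ h)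
2*h∸k≡h∸[k∸h] {h} {k} h≤k = begin
  2 * h ∸ k             ≡⟨ cong₂ _∸_ (sym (2*m≡m+m h)) (m+[n∸m]≡n h≤k) ⟨
  h + h ∸ (h + (k ∸ h)) ≡⟨ [m+n]∸[m+o]≡n∸o h h (k ∸ h) ⟩
  h ∸ (k ∸ h)           ∎
  where open ≡-Reasoning

map3≡complement∘map1∘complement : h ≤ k → map3 (h , k) ≡ complement (map1 (complement (h , k)))
map3≡complement∘map1∘complement {h} {k} h≤k rewrite m∸[m∸n]≡n h≤k =
  cong (_, h) (2*h∸k≡h∸[k∸h] h≤k)

map4≡complement∘map2∘complement : h ≤ k → map4 (h , k) ≡ complement (map2 (complement (h , k)))
map4≡complement∘map2∘complement {h} {k} h≤k =
  cong₂ _,_ (sym (m+n∸n≡m k (k ∸ h))) (2*k∸h≡k+[k∸h] h≤k)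

map5≡complement∘map1 : ∀ x → map5 x ≡ complement (map1 x)
map5≡complement∘map1 (h , k) =
  cong (_, k ∸ h) (trans (cong (k ∸_) (2*m≡m+m h)) (sym (∸-+-assoc k h h)))

map6≡map2∘complement : h ≤ k → map6 (h , k) ≡ map2 (complement (h , k))
map6≡map2∘complement {h} {k} h≤k = cong (k ∸ h ,_) (2*k∸h≡k+[k∸h] h≤k)

map7≡map1∘complement : h ≤ k → map7 (h , k) ≡ map1 (complement (h , k))
map7≡map1∘complement {h} {k} h≤k = cong (k ∸ h ,_) (sym (m∸[m∸n]≡n h≤k))

map8≡complement∘map2 : ∀ x → map8 x ≡ complement (map2 x)
map8≡complement∘map2 (h , k) = cong (_, k + h) (sym (m+n∸n≡m k h))

complement∘map1-antitone : Antitone (complement ∘ map1)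
complement∘map1-antitone = antitone∘monotone {complement} {map1} complement-antitone map1-monotone

map2∘complement-antitone : Antitone (map2 ∘ complement)
map2∘complement-antitone = monotone∘antitone {map2} {complement} map2-monotone complement-antitone

map1∘complement-antitone : Antitone (map1 ∘ complement)
map1∘complement-antitone = monotone∘antitone {map1} {complement} map1-monotone complement-antitone

complement∘map2-antitone : Antitone (complement ∘ map2)
complement∘map2-antitone = antitone∘monotone {complement} {map2} complement-antitone map2-monotone

module _ {n m m' : ℕ} (m+m'≡n : m + m' ≡ n) where

  private
    m'+m≡n : m' + m ≡ n
    m'+m≡n = trans (+-comm m' m) m+m'≡n

  map1-map2-bijections :
    IncBij (FNM≤½ n m) (FareyF m' (+ m)) map1 × IncBij (FareyF m' (+ m)) (FNM≤½ n m) map2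
  map1-map2-bijections = Inverse⇒IncBij (map1-map2-inverse m+m'≡n)
    (λ x y _ _ → map1-monotone x y) (λ x y _ _ → map2-monotone x y)

  map7-map8-bijections :
    DecBij (FNM≥½ n m) (FareyF m (+ m')) map7 × DecBij (FareyF m (+ m')) (FNM≥½ n m) map8
  map7-map8-bijections = Inverse⇒DecBij
    (Inverse-equalOn map7≐ map8≐
      (Inverse-∘ (FNM-complement-inverse m+m'≡n) (map1-map2-inverse m'+m≡n)))
    (reversing-equalOn map7≐ map1∘complement-antitone)
    (reversing-equalOn map8≐ complement∘map2-antitone)
    where
    map7≐ : EqualOn (FNM≥½ n m) map7 (map1 ∘ complement)
    map7≐ = equalOn-atMostOne FNM≥½-atMostOne map7≡map1∘complement
    map8≐ : EqualOn (FareyF m (+ m')) map8 (complement ∘ map2)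
    map8≐ x _ = map8≡complement∘map2 x

  map5-map6-bijections :
    DecBij (FNM≤½ n m) (FareyG m' (+ n ℤ.- + (2 * m))) map5 ×
    DecBij (FareyG m' (+ n ℤ.- + (2 * m))) (FNM≤½ n m) map6
  map5-map6-bijections = Inverse⇒DecBij
    (Inverse-equalOn map5≐ map6≐
      (Inverse-∘ (map1-map2-inverse m+m'≡n)
                 (FareyF-complement-inverse {p' = + n ℤ.- + (2 * m)} m+[n−2m]≡m')))
    (reversing-equalOn map5≐ complement∘map1-antitone)
    (reversing-equalOn map6≐ map2∘complement-antitone)
    where
    map5≐ : EqualOn (FNM≤½ n m) map5 (complement ∘ map1)
    map5≐ x _ = map5≡complement∘map1 x
    map6≐ : EqualOn (FareyG m' (+ n ℤ.- + (2 * m))) map6 (map2 ∘ complement)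
    map6≐ = equalOn-atMostOne (FareyG-atMostOne {p = + n ℤ.- + (2 * m)}) map6≡map2∘complement
    m+[n−2m]≡m' : + m ℤ.+ (+ n ℤ.- + (2 * m)) ≡ + m'
    m+[n−2m]≡m' rewrite sym m+m'≡n = identity (+ m) (+ m')
      where
      -- + (2 * m) unfolds definitionally to + m ℤ.+ (+ m ℤ.+ ℤ.0ℤ).
      identity : ∀ M M' → M ℤ.+ ((M ℤ.+ M') ℤ.- (M ℤ.+ (M ℤ.+ ℤ.0ℤ))) ≡ M'
      identity = ℤ-Solver.solve-∀

  map3-map4-bijections :
    IncBij (FNM≥½ n m) (FareyG m (+ (2 * m) ℤ.- + n)) map3 ×
    IncBij (FareyG m (+ (2 * m) ℤ.- + n)) (FNM≥½ n m) map4
  map3-map4-bijections = Inverse⇒IncBij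
    (Inverse-equalOn map3≐ map4≐
      (Inverse-∘ (Inverse-∘ (FNM-complement-inverse m+m'≡n) (map1-map2-inverse m'+m≡n))
                 (FareyF-complement-inverse {p' = + (2 * m) ℤ.- + n} m'+[2m−n]≡m)))
    (preserving-equalOn map3≐
      (antitone∘antitone {complement} {map1 ∘ complement} complement-antitone
        map1∘complement-antitone))
    (preserving-equalOn map4≐
      (antitone∘antitone {complement ∘ map2} {complement} complement∘map2-antitone
        complement-antitone))
    where
    map3≐ : EqualOn (FNM≥½ n m) map3 (complement ∘ map1 ∘ complement)
    map3≐ = equalOn-atMostOne FNM≥½-atMostOne map3≡complement∘map1∘complement
    map4≐ : EqualOn (FareyG m (+ (2 * m) ℤ.- + n)) map4 (complement ∘ map2 ∘ complement)
    map4≐ = equalOn-atMostOne (FareyG-atMostOne {p = + (2 * m) ℤ.- + n}) map4≡complement∘map2∘complement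
    m'+[2m−n]≡m : + m' ℤ.+ (+ (2 * m) ℤ.- + n) ≡ + m
    m'+[2m−n]≡m rewrite sym m+m'≡n = identity (+ m) (+ m')
      where
      identity : ∀ M M' → M' ℤ.+ ((M ℤ.+ (M ℤ.+ ℤ.0ℤ)) ℤ.- (M ℤ.+ M')) ≡ M
      identity = ℤ-Solver.solve-∀

theorem1 : (n m : ℕ) → 1 < n → 0 < m → m < n →
    IncBij (FNM≤½ n m) (FareyF (n ∸ m) (+ m)) map1 ×
    IncBij (FareyF (n ∸ m) (+ m)) (FNM≤½ n m) map2 ×
    IncBij (FNM≥½ n m) (FareyG m ((+ (2 * m)) ℤ.- (+ n))) map3 ×
    IncBij (FareyG m ((+ (2 * m)) ℤ.- (+ n))) (FNM≥½ n m) map4 ×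
    DecBij (FNM≤½ n m) (FareyG (n ∸ m) ((+ n) ℤ.- (+ (2 * m)))) map5 ×
    DecBij (FareyG (n ∸ m) ((+ n) ℤ.- (+ (2 * m)))) (FNM≤½ n m) map6 ×
    DecBij (FNM≥½ n m) (FareyF m (+ (n ∸ m))) map7 ×
    DecBij (FareyF m (+ (n ∸ m))) (FNM≥½ n m) map8
theorem1 n m _ _ m<n =
  let m+m'≡n = m+[n∸m]≡n (<⇒≤ m<n)
      b₁ , b₂ = map1-map2-bijections m+m'≡n
      b₃ , b₄ = map3-map4-bijections m+m'≡n
      b₅ , b₆ = map5-map6-bijections m+m'≡n
      b₇ , b₈ = map7-map8-bijections m+m'≡n
  in b₁ , b₂ , b₃ , b₄ , b₅ , b₆ , b₇ , b₈
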